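{- Let $G$ be a finite multigraph (loops and multiple edges allowed) with vertex set $\{1,\dots,n\}$, and consider Process A (defined in the context) at any stage at which at least one edge is still unprocessed. Then there is a pair of vertices $i,j$ (possibly $i=j$) with $\mu_{ij}\ge 1$ such that the number of faces that can be closed by processing an edge joining $i$ and $j$ is at most $2\mu_{ij}$, where $\mu_{ij}$ denotes the number of currently unprocessed edges joining $i$ and $j$.
   Context: Each edge consists of two darts (for a loop both are at its vertex); the degree $d_i$ of vertex $i$ is the number of darts at $i$. Process A: at each vertex $i$ fix a cyclically ordered set of $d_i$ positions; for a position $x$ let $R(x)$ be its successor in the cyclic order at its vertex. Edges are processed one at a time in an arbitrary order; processing an edge joining $i$ and $j$ means choosing an unoccupied position $p$ at $i$ and an unoccupied position $q$ at $j$ (distinct if $i=j$) and placing the two darts of the edge there; we then set $\theta(p)=q$, $\theta(q)=p$, and $p,q$ become occupied. At any stage, a partial facial walk starting at an unoccupied position $s$ is defined as follows: let $x=R(s)$; while $x$ is occupied, replace $x$ by $R(\theta(x))$; the walk ends at the first unoccupied position $t$ reached (possibly $t=s$). We say the walk goes from $s$ to $t$. Pairing two distinct unoccupied positions $p$ (at $i$) and $q$ (at $j$) closes a face if some partial facial walk goes from $p$ to $q$ or from $q$ to $p$. The number of faces that can be closed by processing an edge joining $i$ and $j$ is the number of unordered pairs $\{p,q\}$ of distinct unoccupied positions, one at $i$ and one at $j$, whose pairing closes a face. -}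

module Defs where

open import Data.Nat using (ℕ; zero; suc; _+_; _*_; _<_; _<?_)
open import Data.Fin using (Fin; zero; suc; toℕ; fromℕ<) renaming (_≟_ to _≟ᶠ_)
open import Data.Bool using (Bool; true; false; if_then_else_; _∧_; _∨_; not)
open import Data.Maybe using (Maybe; just; nothing)
open import Data.Product using (Σ; _×_; _,_; proj₁; proj₂)
open import Data.Product.Properties using (≡-dec)
open import Data.List using (List; map; allFin; cartesianProduct)
open import Data.Nat.ListAction using (sum)
open import Relation.Nullary using (yes; no; ¬_)
open import Relation.Nullary.Decidable using (⌊_⌋)
open import Relation.Binary.PropositionalEquality using (_≡_)

csuc : ∀ {k} → Fin k → Fin k
csuc {suc k} x with suc (toℕ x) <? suc k
... | yes p = fromℕ< p
... | no _  = zero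

-- A finite multigraph on vertex set Fin n (≅ {1,…,n}) with m edges;
-- edge e joins the endpoints  ends e = (u , v)  (a loop if u = v).
-- Its first dart sits at u, its second dart at v.
module ProcessA {n m : ℕ} (ends : Fin m → Fin n × Fin n) where

  ind : Bool → ℕ
  ind true  = 1
  ind false = 0

  deg : Fin n → ℕ
  deg i = sum (map (λ e → ind ⌊ proj₁ (ends e) ≟ᶠ i ⌋ + ind ⌊ proj₂ (ends e) ≟ᶠ i ⌋) (allFin m))

  Pos : Set
  Pos = Σ (Fin n) (λ i → Fin (deg i))

  _≟ₚ_ : (x y : Pos) → Relation.Nullary.Dec (x ≡ y)
  _≟ₚ_ = ≡-dec _≟ᶠ_ _≟ᶠ_

  R : Pos → Pos
  R (i , x) = (i , csuc x)

  -- A stage of Process A: which edges are processed, and the partial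
  -- pairing θ of positions (θ x = nothing iff x is unoccupied).
  record State : Set where
    constructor state
    field
      done : Fin m → Bool
      θ    : Pos → Maybe Pos
  open State public

  initial : State
  initial = state (λ _ → false) (λ _ → nothing)

  process : State → Fin m → Pos → Pos → State
  process (state d t) e p q =
    state (λ f → if ⌊ f ≟ᶠ e ⌋ then true else d f)
          (λ x → if ⌊ x ≟ₚ p ⌋ then just q else if ⌊ x ≟ₚ q ⌋ then just p else t x)

  data Reachable : State → Set where
    start : Reachable initial
    step  : ∀ {s} → Reachable s → (e : Fin m) (p q : Pos) →
            done s e ≡ false →
            proj₁ p ≡ proj₁ (ends e) → proj₁ q ≡ proj₂ (ends e) →
            θ s p ≡ nothing → θ s q ≡ nothing → ¬ (p ≡ q) →
            Reachable (process s e p q)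

  occupied : State → Pos → Bool
  occupied s x with θ s x
  ... | just _  = true
  ... | nothing = false

  walkFrom : State → ℕ → Pos → Maybe Pos
  walkFrom s zero    x = nothing
  walkFrom s (suc f) x with θ s x
  ... | nothing = just x
  ... | just y  = walkFrom s f (R y)

  -- The partial facial walk starting at s₀ (visits at most 2m occupied
  -- positions, so fuel 2m+1 always suffices): walk s s₀ ≡ just t means
  -- the walk goes from s₀ to t.
  walk : State → Pos → Maybe Pos
  walk s s₀ = walkFrom s (suc (2 * m)) (R s₀)

  goesTo : State → Pos → Pos → Bool
  goesTo s p q with walk s p
  ... | just t  = ⌊ t ≟ₚ q ⌋
  ... | nothing = false

  closes : State → Pos → Pos → Bool
  closes s p q = goesTo s p q ∨ goesTo s q p

  -- Each unordered pair is listed once: for i ≠ j as (p at i, q at j);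
  -- for i = j as (p,q) with index of p < index of q.
  closable : State → Fin n → Fin n → ℕ
  closable s i j =
    sum (map (λ ab →
        let p = (i , proj₁ ab) ; q = (j , proj₂ ab) in
        ind ((not ⌊ i ≟ᶠ j ⌋ ∨ ⌊ toℕ (proj₁ ab) <? toℕ (proj₂ ab) ⌋)
             ∧ not (occupied s p) ∧ not (occupied s q) ∧ closes s p q))
      (cartesianProduct (allFin (deg i)) (allFin (deg j))))

  joins : Fin m → Fin n → Fin n → Bool
  joins e i j = (⌊ proj₁ (ends e) ≟ᶠ i ⌋ ∧ ⌊ proj₂ (ends e) ≟ᶠ j ⌋)
              ∨ (⌊ proj₁ (ends e) ≟ᶠ j ⌋ ∧ ⌊ proj₂ (ends e) ≟ᶠ i ⌋)

  μ : State → Fin n → Fin n → ℕ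
  μ s i j = sum (map (λ e → ind (not (done s e) ∧ joins e i j)) (allFin m))

-- Every unoccupied position x starts exactly one partial facial walk, which ends at
-- at most one position y; call (x, y) an arc.  Pairing p with q closes a face only if
-- (p, q) or (q, p) is an arc, so the closable pairs are bounded by the arcs, and there
-- are no more arcs than unoccupied positions, i.e. 2·E where E is the number of
-- unprocessed edges.  Weight the vertex pair (i, j) by 2 if i = j and by 1 otherwise:
-- summed over all ordered pairs (i, j), the weighted numbers of closable pairs total at
-- most 2·(2·E), while the weighted μ_ij total at least 2·E (each unprocessed edge is
-- seen from both of its ends).  Hence some (i, j) with μ_ij ≥ 1 has closable ≤ 2·μ_ij.
module Submission where

open import Data.Bool using (Bool; true; false; T; _∧_; _∨_; not)
open import Data.Fin using (Fin; zero; suc; toℕ) renaming (_≟_ to _≟ᶠ_)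
import Data.Fin.Properties as Finₚ
open import Data.List using (List; []; _∷_; _++_; map; allFin; tabulate; cartesianProduct)
open import Data.List.Properties using (map-++; map-∘; map-tabulate)
open import Data.Maybe using (just; nothing)
open import Data.Nat using (ℕ; zero; suc; NonZero; _+_; _*_; _≤_; _<_; z≤n; s≤s; z<s; _≤?_; _<?_)
open import Data.Nat.ListAction using (sum)
open import Data.Nat.ListAction.Properties using (sum-++)
open import Data.Nat.Properties
open import Data.Product as Σ using (_×_; _,_; proj₁; proj₂; ∃; ∃₂)
open import Function using (_∘_; id)
open import Relation.Binary.PropositionalEquality
open import Relation.Nullary using (Dec; yes; no; ¬_; contradiction)
open import Relation.Nullary.Decidable using (⌊_⌋)

open import Algebra.Properties.CommutativeSemigroup *-commutativeSemigroup using (x∙yz≈y∙xz)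
open import Algebra.Properties.Semiring.Sum +-*-semiring
  using (sum-syntax; sum-cong-≗; sum-replicate-zero; ∑-distrib-+; ∑-comm; *-distribˡ-sum)
  renaming (sum to ∑)

open import Defs

sum-tabulate : ∀ {k} (f : Fin k → ℕ) → sum (tabulate f) ≡ ∑ f
sum-tabulate {zero}  f = refl
sum-tabulate {suc k} f = cong (f zero +_) (sum-tabulate (f ∘ suc))

sum-map-allFin : ∀ {k} (f : Fin k → ℕ) → sum (map f (allFin k)) ≡ ∑ f
sum-map-allFin f = trans (cong sum (map-tabulate id f)) (sum-tabulate f)

sum-map-cartesianProduct : ∀ {A B : Set} (g : A × B → ℕ) (xs : List A) (ys : List B) →
  sum (map g (cartesianProduct xs ys)) ≡ sum (map (λ x → sum (map (λ y → g (x , y)) ys)) xs)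
sum-map-cartesianProduct g []       ys = refl
sum-map-cartesianProduct g (x ∷ xs) ys = begin
  sum (map g (map (x ,_) ys ++ cartesianProduct xs ys))
    ≡⟨ cong sum (map-++ g (map (x ,_) ys) _) ⟩
  sum (map g (map (x ,_) ys) ++ map g (cartesianProduct xs ys))
    ≡⟨ sum-++ (map g (map (x ,_) ys)) _ ⟩
  sum (map g (map (x ,_) ys)) + sum (map g (cartesianProduct xs ys))
    ≡⟨ cong₂ _+_ (cong sum (sym (map-∘ ys))) (sum-map-cartesianProduct g xs ys) ⟩
  sum (map (λ y → g (x , y)) ys) + sum (map (λ x → sum (map (λ y → g (x , y)) ys)) xs)
    ∎
  where open ≡-Reasoning

sum-map-allFin-cartesianProduct : ∀ {a b} (g : Fin a × Fin b → ℕ) →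
  sum (map g (cartesianProduct (allFin a) (allFin b))) ≡ ∑[ x < a ] ∑[ y < b ] g (x , y)
sum-map-allFin-cartesianProduct {a} {b} g =
  trans (sum-map-cartesianProduct g (allFin a) (allFin b))
        (trans (sum-map-allFin (λ x → sum (map (λ y → g (x , y)) (allFin b)))) (sum-cong-≗ (λ x → sum-map-allFin (λ y → g (x , y)))))

∑-const : ∀ k c → ∑[ i < k ] c ≡ c * k
∑-const zero    c = sym (*-zeroʳ c)
∑-const (suc k) c = trans (cong (c +_) (∑-const k c)) (sym (*-suc c k))

∑-zero : ∀ {k} {f : Fin k → ℕ} → (∀ i → f i ≡ 0) → ∑ f ≡ 0
∑-zero {k} f≗0 = trans (sum-cong-≗ f≗0) (sum-replicate-zero k)

∑-mono-≤ : ∀ {k} {f g : Fin k → ℕ} → (∀ i → f i ≤ g i) → ∑ f ≤ ∑ g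
∑-mono-≤ {zero}  f≤g = z≤n
∑-mono-≤ {suc k} f≤g = +-mono-≤ (f≤g zero) (∑-mono-≤ (f≤g ∘ suc))

∑₂-distrib-+ : ∀ {k l} (f g : Fin k → Fin l → ℕ) →
  ∑[ a < k ] ∑[ b < l ] (f a b + g a b) ≡ ∑[ a < k ] ∑[ b < l ] f a b + ∑[ a < k ] ∑[ b < l ] g a b
∑₂-distrib-+ f g = trans (sum-cong-≗ (λ a → ∑-distrib-+ (f a) (g a))) (∑-distrib-+ (λ a → ∑ (f a)) (λ a → ∑ (g a)))

term≤∑ : ∀ {k} (f : Fin k → ℕ) i → f i ≤ ∑ f
term≤∑ f zero    = m≤m+n _ _
term≤∑ f (suc i) = ≤-trans (term≤∑ (f ∘ suc) i) (m≤n+m _ _)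

term≤∑₂ : ∀ {k l} (f : Fin k → Fin l → ℕ) i j → f i j ≤ ∑[ a < k ] ∑[ b < l ] f a b
term≤∑₂ f i j = ≤-trans (term≤∑ (f i) j) (term≤∑ (λ a → ∑ (f a)) i)

∑-concentrated : ∀ {k} (f : Fin k → ℕ) c → (∀ i → i ≢ c → f i ≡ 0) → ∑ f ≡ f c
∑-concentrated f zero    off = trans (cong (f zero +_) (∑-zero (λ i → off (suc i) λ ()))) (+-identityʳ _)
∑-concentrated f (suc c) off =
  trans (cong (_+ ∑ (f ∘ suc)) (off zero λ ()))
        (∑-concentrated (f ∘ suc) c (λ i i≢c → off (suc i) (i≢c ∘ Finₚ.suc-injective)))

0<m*n⇒0<n : ∀ m {n} → 0 < m * n → 0 < n
0<m*n⇒0<n m {zero}  0<m*0 = contradiction (*-zeroʳ m) (>⇒≢ 0<m*0)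
0<m*n⇒0<n m {suc n} _     = z<s

cancel-weight : ∀ w k {c d} .{{_ : NonZero w}} → 0 < w * d → w * c ≤ k * (w * d) → 0 < d × c ≤ k * d
cancel-weight w k {c} {d} 0<wd wc≤kwd =
  0<m*n⇒0<n w 0<wd , *-cancelˡ-≤ w (≤-trans wc≤kwd (≤-reflexive (x∙yz≈y∙xz k w d)))

private
  dropHead-≤ : ∀ k {c₀ d₀ C D} → k * d₀ ≤ c₀ → c₀ + C ≤ k * (d₀ + D) → C ≤ k * D
  dropHead-≤ k {c₀} {d₀} {C} {D} kd₀≤c₀ le = +-cancelˡ-≤ (k * d₀) C (k * D) (begin
    k * d₀ + C   ≤⟨ +-monoˡ-≤ C kd₀≤c₀ ⟩
    c₀ + C       ≤⟨ le ⟩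
    k * (d₀ + D) ≡⟨ *-distribˡ-+ k d₀ D ⟩
    k * d₀ + k * D ∎)
    where open ≤-Reasoning

  dropHead-< : ∀ k {c₀ d₀ C D} → k * d₀ < c₀ → c₀ + C ≤ k * (d₀ + D) → C < k * D
  dropHead-< k {c₀} {d₀} {C} {D} kd₀<c₀ le = +-cancelˡ-< (k * d₀) C (k * D) (begin-strict
    k * d₀ + C   <⟨ +-monoˡ-< C kd₀<c₀ ⟩
    c₀ + C       ≤⟨ le ⟩
    k * (d₀ + D) ≡⟨ *-distribˡ-+ k d₀ D ⟩
    k * d₀ + k * D ∎)
    where open ≤-Reasoning

averaging : ∀ {N} k (c d : Fin N → ℕ) → ∑ c ≤ k * ∑ d → 0 < ∑ d →
            ∃ λ i → 0 < d i × c i ≤ k * d i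
averaging {zero}  k c d _ ()
averaging {suc N} k c d ∑c≤k∑d 0<∑d with c zero ≤? k * d zero | 0 <? d zero
... | yes c₀≤kd₀ | yes 0<d₀ = zero , 0<d₀ , c₀≤kd₀
... | yes _      | no 0≮d₀  =
  Σ.map suc id (averaging k (c ∘ suc) (d ∘ suc) (dropHead-≤ k kd₀≤c₀ ∑c≤k∑d)
                          (subst (λ x → 0 < x + ∑ (d ∘ suc)) d₀≡0 0<∑d))
  where
  d₀≡0 : d zero ≡ 0
  d₀≡0 = n≤0⇒n≡0 (≮⇒≥ 0≮d₀)
  kd₀≤c₀ : k * d zero ≤ c zero
  kd₀≤c₀ = ≤-trans (≤-reflexive (trans (cong (k *_) d₀≡0) (*-zeroʳ k))) z≤n
... | no c₀≰kd₀  | _        =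
  Σ.map suc id (averaging k (c ∘ suc) (d ∘ suc) (<⇒≤ ∑c′<k∑d′) (0<m*n⇒0<n k (≤-<-trans z≤n ∑c′<k∑d′)))
  where
  ∑c′<k∑d′ : ∑ (c ∘ suc) < k * ∑ (d ∘ suc)
  ∑c′<k∑d′ = dropHead-< k (≰⇒> c₀≰kd₀) ∑c≤k∑d

averaging₂ : ∀ {N M} k (c d : Fin N → Fin M → ℕ) →
             ∑[ i < N ] ∑[ j < M ] c i j ≤ k * ∑[ i < N ] ∑[ j < M ] d i j →
             0 < ∑[ i < N ] ∑[ j < M ] d i j →
             ∃₂ λ i j → 0 < d i j × c i j ≤ k * d i j
averaging₂ k c d ∑c≤k∑d 0<∑d =
  let i , 0<∑dᵢ , ∑cᵢ≤k∑dᵢ = averaging k (λ i → ∑ (c i)) (λ i → ∑ (d i)) ∑c≤k∑d 0<∑d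
      j , hj = averaging k (c i) (d i) ∑cᵢ≤k∑dᵢ 0<∑dᵢ
  in i , j , hj

module FaceCounting {n m : ℕ} (ends : Fin m → Fin n × Fin n) where
  open ProcessA ends

  ind-yes : ∀ {P : Set} (p? : Dec P) → P → ind ⌊ p? ⌋ ≡ 1
  ind-yes (yes _) _ = refl
  ind-yes (no ¬p) p = contradiction p ¬p

  ind-no : ∀ {P : Set} (p? : Dec P) → ¬ P → ind ⌊ p? ⌋ ≡ 0
  ind-no (yes p) ¬p = contradiction p ¬p
  ind-no (no _)  _  = refl

  ind-guarded : ∀ l {x y z} → ind x ≤ ind y + ind z → ind (l ∧ x) ≤ ind (l ∧ y) + ind (l ∧ z)
  ind-guarded true  x≤y+z = x≤y+z
  ind-guarded false _     = z≤n

  ind-∧-∧-∨ : ∀ x y g h → ind (x ∧ y ∧ (g ∨ h)) ≤ ind (x ∧ g) + ind (y ∧ h)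
  ind-∧-∧-∨ false _     _     _ = z≤n
  ind-∧-∧-∨ true  false _     _ = z≤n
  ind-∧-∧-∨ true  true  true  _ = s≤s z≤n
  ind-∧-∧-∨ true  true  false h = ≤-refl

  ind-+-≤-∨ : ∀ {w} x y → 1 ≤ w → (T x → T y → 2 ≤ w) → ind x + ind y ≤ w * ind (x ∨ y)
  ind-+-≤-∨ {w} false false _   _    = z≤n
  ind-+-≤-∨ {w} false true  1≤w _    = ≤-trans 1≤w (≤-reflexive (sym (*-identityʳ w)))
  ind-+-≤-∨ {w} true  false 1≤w _    = ≤-trans 1≤w (≤-reflexive (sym (*-identityʳ w)))
  ind-+-≤-∨ {w} true  true  _   both = ≤-trans (both _ _) (≤-reflexive (sym (*-identityʳ w)))

  ∑ₚ : (Pos → ℕ) → ℕ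
  ∑ₚ F = ∑[ i < n ] ∑[ a < deg i ] F (i , a)

  ∑ₚ-cong : ∀ {F G : Pos → ℕ} → (∀ x → F x ≡ G x) → ∑ₚ F ≡ ∑ₚ G
  ∑ₚ-cong F≗G = sum-cong-≗ (λ i → sum-cong-≗ (λ a → F≗G (i , a)))

  ∑ₚ-mono-≤ : ∀ {F G : Pos → ℕ} → (∀ x → F x ≤ G x) → ∑ₚ F ≤ ∑ₚ G
  ∑ₚ-mono-≤ F≤G = ∑-mono-≤ (λ i → ∑-mono-≤ (λ a → F≤G (i , a)))

  ∑ₚ-distrib-+ : ∀ (F G : Pos → ℕ) → ∑ₚ (λ x → F x + G x) ≡ ∑ₚ F + ∑ₚ G
  ∑ₚ-distrib-+ F G = trans (sum-cong-≗ (λ i → ∑-distrib-+ (λ a → F (i , a)) (λ a → G (i , a))))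
                           (∑-distrib-+ (λ i → ∑ (λ a → F (i , a))) (λ i → ∑ (λ a → G (i , a))))

  ∑ₚ-zero : ∀ {F : Pos → ℕ} → (∀ x → F x ≡ 0) → ∑ₚ F ≡ 0
  ∑ₚ-zero F≗0 = ∑-zero (λ i → ∑-zero {deg i} (λ a → F≗0 (i , a)))

  ∑ₚ-concentrated : ∀ (F : Pos → ℕ) t → (∀ x → x ≢ t → F x ≡ 0) → ∑ₚ F ≡ F t
  ∑ₚ-concentrated F (i , a) off =
    trans (∑-concentrated _ i (λ j j≢i → ∑-zero (λ b → off (j , b) (j≢i ∘ cong proj₁))))
          (∑-concentrated _ a (λ b b≢a → off (i , b) (b≢a ∘ λ { refl → refl })))

  ∑-ind-≟ˡ : ∀ {k} (c : Fin k) → ∑[ i < k ] ind ⌊ c ≟ᶠ i ⌋ ≡ 1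
  ∑-ind-≟ˡ c = trans (∑-concentrated _ c (λ i i≢c → ind-no (c ≟ᶠ i) (i≢c ∘ sym))) (ind-yes (c ≟ᶠ c) refl)

  ∑-ind-≟ʳ : ∀ {k} (c : Fin k) → ∑[ i < k ] ind ⌊ i ≟ᶠ c ⌋ ≡ 1
  ∑-ind-≟ʳ c = trans (∑-concentrated _ c (λ i i≢c → ind-no (i ≟ᶠ c) i≢c)) (ind-yes (c ≟ᶠ c) refl)

  ∑ₚ-ind-≟ˡ : ∀ t → ∑ₚ (λ x → ind ⌊ t ≟ₚ x ⌋) ≡ 1
  ∑ₚ-ind-≟ˡ t = trans (∑ₚ-concentrated _ t (λ x x≢t → ind-no (t ≟ₚ x) (x≢t ∘ sym))) (ind-yes (t ≟ₚ t) refl)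

  ∑ₚ-ind-≟ʳ : ∀ t → ∑ₚ (λ x → ind ⌊ x ≟ₚ t ⌋) ≡ 1
  ∑ₚ-ind-≟ʳ t = trans (∑ₚ-concentrated _ t (λ x x≢t → ind-no (x ≟ₚ t) x≢t)) (ind-yes (t ≟ₚ t) refl)

  handshake : ∑[ i < n ] deg i ≡ 2 * m
  handshake = begin
    ∑[ i < n ] deg i
      ≡⟨ sum-cong-≗ (λ i → sum-map-allFin (dartsAt i)) ⟩
    ∑[ i < n ] ∑[ e < m ] dartsAt i e
      ≡⟨ ∑-comm dartsAt ⟩
    ∑[ e < m ] ∑[ i < n ] dartsAt i e
      ≡⟨ sum-cong-≗ twoDarts ⟩
    ∑[ e < m ] 2
      ≡⟨ ∑-const m 2 ⟩
    2 * m ∎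
    where
    open ≡-Reasoning
    dartsAt : Fin n → Fin m → ℕ
    dartsAt i e = ind ⌊ proj₁ (ends e) ≟ᶠ i ⌋ + ind ⌊ proj₂ (ends e) ≟ᶠ i ⌋
    twoDarts : ∀ e → ∑[ i < n ] dartsAt i e ≡ 2
    twoDarts e = trans (∑-distrib-+ (λ i → ind ⌊ proj₁ (ends e) ≟ᶠ i ⌋) (λ i → ind ⌊ proj₂ (ends e) ≟ᶠ i ⌋))
                       (cong₂ _+_ (∑-ind-≟ˡ (proj₁ (ends e))) (∑-ind-≟ˡ (proj₂ (ends e))))

  unoccupied : State → Pos → Bool
  unoccupied s x = not (occupied s x)

  #unoccupied : State → ℕ
  #unoccupied s = ∑ₚ (λ x → ind (unoccupied s x))

  #unprocessed : State → ℕ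
  #unprocessed s = ∑[ e < m ] ind (not (done s e))

  #unoccupied-initial : #unoccupied initial ≡ 2 * m
  #unoccupied-initial = trans (sum-cong-≗ (λ i → trans (∑-const (deg i) 1) (*-identityˡ (deg i)))) handshake

  #unprocessed-initial : #unprocessed initial ≡ m
  #unprocessed-initial = trans (∑-const m 1) (*-identityˡ m)

  unoccupied-process : ∀ s e {p q} → θ s p ≡ nothing → θ s q ≡ nothing → p ≢ q → ∀ x →
    ind (unoccupied s x) ≡ ind ⌊ x ≟ₚ p ⌋ + ind ⌊ x ≟ₚ q ⌋ + ind (unoccupied (process s e p q) x)
  unoccupied-process s e {p} {q} p-free q-free p≢q x with x ≟ₚ p | x ≟ₚ q
  ... | yes refl | yes refl = contradiction refl p≢q
  ... | yes refl | no _     rewrite p-free = refl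
  ... | no _     | yes refl rewrite q-free = refl
  ... | no _     | no _     = refl

  unprocessed-process : ∀ s e p q → done s e ≡ false → ∀ f →
    ind (not (done s f)) ≡ ind ⌊ f ≟ᶠ e ⌋ + ind (not (done (process s e p q) f))
  unprocessed-process s e p q e-unprocessed f with f ≟ᶠ e
  ... | yes refl rewrite e-unprocessed = refl
  ... | no _     = refl

  #unoccupied-process : ∀ s e {p q} → θ s p ≡ nothing → θ s q ≡ nothing → p ≢ q →
    #unoccupied s ≡ 2 + #unoccupied (process s e p q)
  #unoccupied-process s e {p} {q} p-free q-free p≢q = begin
    #unoccupied s
      ≡⟨ ∑ₚ-cong (unoccupied-process s e p-free q-free p≢q) ⟩
    ∑ₚ (λ x → ind ⌊ x ≟ₚ p ⌋ + ind ⌊ x ≟ₚ q ⌋ + ind (unoccupied s′ x))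
      ≡⟨ ∑ₚ-distrib-+ _ _ ⟩
    ∑ₚ (λ x → ind ⌊ x ≟ₚ p ⌋ + ind ⌊ x ≟ₚ q ⌋) + #unoccupied s′
      ≡⟨ cong (_+ #unoccupied s′) (trans (∑ₚ-distrib-+ _ _) (cong₂ _+_ (∑ₚ-ind-≟ʳ p) (∑ₚ-ind-≟ʳ q))) ⟩
    2 + #unoccupied s′ ∎
    where
    open ≡-Reasoning
    s′ = process s e p q

  #unprocessed-process : ∀ s e p q → done s e ≡ false → #unprocessed s ≡ 1 + #unprocessed (process s e p q)
  #unprocessed-process s e p q e-unprocessed =
    trans (sum-cong-≗ (unprocessed-process s e p q e-unprocessed))
          (trans (∑-distrib-+ (λ f → ind ⌊ f ≟ᶠ e ⌋) (λ f → ind (not (done (process s e p q) f))))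
                 (cong (_+ #unprocessed (process s e p q)) (∑-ind-≟ʳ e)))

  #unoccupied≡2*#unprocessed : ∀ {s} → Reachable s → #unoccupied s ≡ 2 * #unprocessed s
  #unoccupied≡2*#unprocessed start = trans #unoccupied-initial (cong (2 *_) (sym #unprocessed-initial))
  #unoccupied≡2*#unprocessed (step {s} r e p q e-unprocessed _ _ p-free q-free p≢q) =
    +-cancelˡ-≡ 2 _ _ (begin
      2 + #unoccupied s′         ≡⟨ #unoccupied-process s e p-free q-free p≢q ⟨
      #unoccupied s              ≡⟨ #unoccupied≡2*#unprocessed r ⟩
      2 * #unprocessed s         ≡⟨ cong (2 *_) (#unprocessed-process s e p q e-unprocessed) ⟩
      2 * (1 + #unprocessed s′)  ≡⟨ *-distribˡ-+ 2 1 (#unprocessed s′) ⟩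
      2 + 2 * #unprocessed s′    ∎)
    where
    open ≡-Reasoning
    s′ = process s e p q

  0<#unprocessed : ∀ s → ∃ (λ e → done s e ≡ false) → 0 < #unprocessed s
  0<#unprocessed s (e , e-unprocessed) =
    ≤-trans (≤-reflexive (cong (λ b → ind (not b)) (sym e-unprocessed))) (term≤∑ (λ f → ind (not (done s f))) e)

  walkArc : State → Pos → Pos → Bool
  walkArc s x y = unoccupied s x ∧ goesTo s x y

  ∑ₚ-walkArc≤unoccupied : ∀ s x → ∑ₚ (λ y → ind (walkArc s x y)) ≤ ind (unoccupied s x)
  ∑ₚ-walkArc≤unoccupied s x with unoccupied s x | walk s x
  ... | false | _       = ≤-reflexive (∑ₚ-zero (λ _ → refl))
  ... | true  | just t  = ≤-reflexive (∑ₚ-ind-≟ˡ t)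
  ... | true  | nothing = ≤-trans (≤-reflexive (∑ₚ-zero (λ _ → refl))) z≤n

  arcsBetween : State → Fin n → Fin n → ℕ
  arcsBetween s i j = ∑[ a < deg i ] ∑[ b < deg j ] ind (walkArc s (i , a) (j , b))

  ∑-arcsBetween≤#unoccupied : ∀ s → ∑[ i < n ] ∑[ j < n ] arcsBetween s i j ≤ #unoccupied s
  ∑-arcsBetween≤#unoccupied s =
    ≤-trans (≤-reflexive (sum-cong-≗ (λ i → ∑-comm (λ j a → ∑[ b < deg j ] ind (walkArc s (i , a) (j , b))))))
            (∑ₚ-mono-≤ (∑ₚ-walkArc≤unoccupied s))

  closable-∑ : ∀ s i j → closable s i j ≡ ∑[ a < deg i ] ∑[ b < deg j ]
    ind ((not ⌊ i ≟ᶠ j ⌋ ∨ ⌊ toℕ a <? toℕ b ⌋) ∧ unoccupied s (i , a) ∧ unoccupied s (j , b) ∧ closes s (i , a) (j , b))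
  closable-∑ s i j = sum-map-allFin-cartesianProduct λ (a , b) →
    ind ((not ⌊ i ≟ᶠ j ⌋ ∨ ⌊ toℕ a <? toℕ b ⌋) ∧ unoccupied s (i , a) ∧ unoccupied s (j , b) ∧ closes s (i , a) (j , b))

  closingPairs≤arcs : ∀ s i j →
    ∑[ a < deg i ] ∑[ b < deg j ] ind (unoccupied s (i , a) ∧ unoccupied s (j , b) ∧ closes s (i , a) (j , b))
      ≤ arcsBetween s i j + arcsBetween s j i
  closingPairs≤arcs s i j = begin
    ∑[ a < deg i ] ∑[ b < deg j ] ind (unoccupied s (i , a) ∧ unoccupied s (j , b) ∧ closes s (i , a) (j , b))
      ≤⟨ ∑-mono-≤ (λ a → ∑-mono-≤ (λ b → ind-∧-∧-∨ (unoccupied s (i , a)) (unoccupied s (j , b)) _ _)) ⟩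
    ∑[ a < deg i ] ∑[ b < deg j ] (arc a b + arc′ a b)
      ≡⟨ ∑₂-distrib-+ arc arc′ ⟩
    arcsBetween s i j + ∑[ a < deg i ] ∑[ b < deg j ] arc′ a b
      ≡⟨ cong (arcsBetween s i j +_) (∑-comm arc′) ⟩
    arcsBetween s i j + arcsBetween s j i ∎
    where
    open ≤-Reasoning
    arc arc′ : Fin (deg i) → Fin (deg j) → ℕ
    arc  a b = ind (walkArc s (i , a) (j , b))
    arc′ a b = ind (walkArc s (j , b) (i , a))

  at-most-one-order : ∀ {k} (a b : Fin k) x → ind (⌊ toℕ a <? toℕ b ⌋ ∧ x) + ind (⌊ toℕ b <? toℕ a ⌋ ∧ x) ≤ ind x
  at-most-one-order a b x with toℕ a <? toℕ b | toℕ b <? toℕ a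
  ... | yes a<b | yes b<a = contradiction b<a (<-asym a<b)
  ... | yes _   | no _    = ≤-reflexive (+-identityʳ _)
  ... | no _    | yes _   = ≤-refl
  ... | no _    | no _    = z≤n

  -- On the diagonal each unordered pair {a, b} is listed only as a < b, so an arc in
  -- either direction between a and b is charged to exactly one of the two orders.
  orderedClosingPairs≤arcs : ∀ s i →
    ∑[ a < deg i ] ∑[ b < deg i ] ind (⌊ toℕ a <? toℕ b ⌋ ∧ unoccupied s (i , a) ∧ unoccupied s (i , b) ∧ closes s (i , a) (i , b))
      ≤ arcsBetween s i i
  orderedClosingPairs≤arcs s i = begin
    ∑[ a < deg i ] ∑[ b < deg i ] ind (a ≺ b ∧ unoccupied s (i , a) ∧ unoccupied s (i , b) ∧ closes s (i , a) (i , b))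
      ≤⟨ ∑-mono-≤ (λ a → ∑-mono-≤ (λ b → ind-guarded (a ≺ b) (ind-∧-∧-∨ (unoccupied s (i , a)) (unoccupied s (i , b)) _ _))) ⟩
    ∑[ a < deg i ] ∑[ b < deg i ] (ind (a ≺ b ∧ arc a b) + ind (a ≺ b ∧ arc b a))
      ≡⟨ ∑₂-distrib-+ (λ a b → ind (a ≺ b ∧ arc a b)) (λ a b → ind (a ≺ b ∧ arc b a)) ⟩
    ∑[ a < deg i ] ∑[ b < deg i ] ind (a ≺ b ∧ arc a b) + ∑[ a < deg i ] ∑[ b < deg i ] ind (a ≺ b ∧ arc b a)
      ≡⟨ cong (∑[ a < deg i ] ∑[ b < deg i ] ind (a ≺ b ∧ arc a b) +_) (∑-comm (λ a b → ind (a ≺ b ∧ arc b a))) ⟩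
    ∑[ a < deg i ] ∑[ b < deg i ] ind (a ≺ b ∧ arc a b) + ∑[ a < deg i ] ∑[ b < deg i ] ind (b ≺ a ∧ arc a b)
      ≡⟨ ∑₂-distrib-+ (λ a b → ind (a ≺ b ∧ arc a b)) (λ a b → ind (b ≺ a ∧ arc a b)) ⟨
    ∑[ a < deg i ] ∑[ b < deg i ] (ind (a ≺ b ∧ arc a b) + ind (b ≺ a ∧ arc a b))
      ≤⟨ ∑-mono-≤ (λ a → ∑-mono-≤ (λ b → at-most-one-order a b (arc a b))) ⟩
    arcsBetween s i i ∎
    where
    open ≤-Reasoning
    _≺_ : Fin (deg i) → Fin (deg i) → Bool
    a ≺ b = ⌊ toℕ a <? toℕ b ⌋
    arc : Fin (deg i) → Fin (deg i) → Bool
    arc a b = walkArc s (i , a) (i , b)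

  -- A loop at i is seen from i only once, an edge between i ≠ j from both (i, j) and (j, i);
  -- doubling the diagonal makes every unprocessed edge weigh 2 in ∑ᵢⱼ loopWeight i j * μ s i j.
  loopWeight : Fin n → Fin n → ℕ
  loopWeight i j = suc (ind ⌊ i ≟ᶠ j ⌋)

  closable-weighted≤arcs : ∀ s i j → loopWeight i j * closable s i j ≤ arcsBetween s i j + arcsBetween s j i
  closable-weighted≤arcs s i j rewrite closable-∑ s i j with i ≟ᶠ j
  ... | yes refl = +-mono-≤ (orderedClosingPairs≤arcs s i) (≤-trans (≤-reflexive (*-identityˡ _)) (orderedClosingPairs≤arcs s i))
  ... | no _     = ≤-trans (≤-reflexive (*-identityˡ _)) (closingPairs≤arcs s i j)

  ∑-weighted-closable≤2*#unoccupied : ∀ s →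
    ∑[ i < n ] ∑[ j < n ] (loopWeight i j * closable s i j) ≤ 2 * #unoccupied s
  ∑-weighted-closable≤2*#unoccupied s = begin
    ∑[ i < n ] ∑[ j < n ] (loopWeight i j * closable s i j)
      ≤⟨ ∑-mono-≤ (λ i → ∑-mono-≤ (λ j → closable-weighted≤arcs s i j)) ⟩
    ∑[ i < n ] ∑[ j < n ] (arcsBetween s i j + arcsBetween s j i)
      ≡⟨ ∑₂-distrib-+ (arcsBetween s) (λ i j → arcsBetween s j i) ⟩
    ∑[ i < n ] ∑[ j < n ] arcsBetween s i j + ∑[ i < n ] ∑[ j < n ] arcsBetween s j i
      ≡⟨ cong (∑[ i < n ] ∑[ j < n ] arcsBetween s i j +_) (∑-comm (λ i j → arcsBetween s j i)) ⟩
    ∑[ i < n ] ∑[ j < n ] arcsBetween s i j + ∑[ i < n ] ∑[ j < n ] arcsBetween s i j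
      ≤⟨ +-mono-≤ (∑-arcsBetween≤#unoccupied s) (m≤n⇒m≤n+o 0 (∑-arcsBetween≤#unoccupied s)) ⟩
    2 * #unoccupied s ∎
    where open ≤-Reasoning

  joinsFromTo : Fin m → Fin n → Fin n → Bool
  joinsFromTo e i j = ⌊ proj₁ (ends e) ≟ᶠ i ⌋ ∧ ⌊ proj₂ (ends e) ≟ᶠ j ⌋

  joinsFromTo-ends : ∀ e → ind (joinsFromTo e (proj₁ (ends e)) (proj₂ (ends e))) ≡ 1
  joinsFromTo-ends e with proj₁ (ends e) ≟ᶠ proj₁ (ends e) | proj₂ (ends e) ≟ᶠ proj₂ (ends e)
  ... | yes _ | yes _ = refl
  ... | no ¬p | _     = contradiction refl ¬p
  ... | yes _ | no ¬p = contradiction refl ¬p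

  joinsFromTo-both⇒loop : ∀ e {i j} → T (joinsFromTo e i j) → T (joinsFromTo e j i) → i ≡ j
  joinsFromTo-both⇒loop e {i} {j} t₁ t₂ with proj₁ (ends e) ≟ᶠ i | proj₁ (ends e) ≟ᶠ j
  ... | yes u≡i | yes u≡j = trans (sym u≡i) u≡j

  joinsFromTo≤weighted-joins : ∀ e i j →
    ind (joinsFromTo e i j) + ind (joinsFromTo e j i) ≤ loopWeight i j * ind (joins e i j)
  joinsFromTo≤weighted-joins e i j = ind-+-≤-∨ (joinsFromTo e i j) (joinsFromTo e j i) (s≤s z≤n)
    (λ t₁ t₂ → ≤-reflexive (cong suc (sym (ind-yes (i ≟ᶠ j) (joinsFromTo-both⇒loop e t₁ t₂)))))

  2≤∑-weighted-joins : ∀ e → 2 ≤ ∑[ i < n ] ∑[ j < n ] (loopWeight i j * ind (joins e i j))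
  2≤∑-weighted-joins e = begin
    2
      ≡⟨ cong₂ _+_ (joinsFromTo-ends e) (joinsFromTo-ends e) ⟨
    ind (joinsFromTo e u v) + ind (joinsFromTo e u v)
      ≤⟨ +-mono-≤ (term≤∑₂ directed u v) (term≤∑₂ (λ i j → directed j i) v u) ⟩
    ∑[ i < n ] ∑[ j < n ] directed i j + ∑[ i < n ] ∑[ j < n ] directed j i
      ≡⟨ ∑₂-distrib-+ directed (λ i j → directed j i) ⟨
    ∑[ i < n ] ∑[ j < n ] (directed i j + directed j i)
      ≤⟨ ∑-mono-≤ (λ i → ∑-mono-≤ (λ j → joinsFromTo≤weighted-joins e i j)) ⟩
    ∑[ i < n ] ∑[ j < n ] (loopWeight i j * ind (joins e i j)) ∎
    where
    open ≤-Reasoning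
    u = proj₁ (ends e)
    v = proj₂ (ends e)
    directed : Fin n → Fin n → ℕ
    directed i j = ind (joinsFromTo e i j)

  weighted-unprocessed≤∑-weighted-joins : ∀ s e →
    2 * ind (not (done s e)) ≤ ∑[ i < n ] ∑[ j < n ] (loopWeight i j * ind (not (done s e) ∧ joins e i j))
  weighted-unprocessed≤∑-weighted-joins s e with done s e
  ... | true  = z≤n
  ... | false = 2≤∑-weighted-joins e

  2*#unprocessed≤∑-weighted-μ : ∀ s → 2 * #unprocessed s ≤ ∑[ i < n ] ∑[ j < n ] (loopWeight i j * μ s i j)
  2*#unprocessed≤∑-weighted-μ s = begin
    2 * #unprocessed s
      ≡⟨ *-distribˡ-sum 2 (λ e → ind (not (done s e))) ⟩
    ∑[ e < m ] (2 * ind (not (done s e)))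
      ≤⟨ ∑-mono-≤ (weighted-unprocessed≤∑-weighted-joins s) ⟩
    ∑[ e < m ] ∑[ i < n ] ∑[ j < n ] edgeTerm e i j
      ≡⟨ ∑-comm (λ e i → ∑[ j < n ] edgeTerm e i j) ⟩
    ∑[ i < n ] ∑[ e < m ] ∑[ j < n ] edgeTerm e i j
      ≡⟨ sum-cong-≗ (λ i → ∑-comm (λ e j → edgeTerm e i j)) ⟩
    ∑[ i < n ] ∑[ j < n ] ∑[ e < m ] edgeTerm e i j
      ≡⟨ sum-cong-≗ (λ i → sum-cong-≗ (λ j → weighted-μ i j)) ⟨
    ∑[ i < n ] ∑[ j < n ] (loopWeight i j * μ s i j) ∎
    where
    open ≤-Reasoning
    edgeTerm : Fin m → Fin n → Fin n → ℕ
    edgeTerm e i j = loopWeight i j * ind (not (done s e) ∧ joins e i j)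
    weighted-μ : ∀ i j → loopWeight i j * μ s i j ≡ ∑[ e < m ] edgeTerm e i j
    weighted-μ i j = trans (cong (loopWeight i j *_) (sum-map-allFin (λ e → ind (not (done s e) ∧ joins e i j))))
                           (*-distribˡ-sum (loopWeight i j) (λ e → ind (not (done s e) ∧ joins e i j)))

mainTheorem3 : {n m : ℕ} (ends : Fin m → Fin n × Fin n) (s : ProcessA.State ends) →
               ProcessA.Reachable ends s →
               ∃ (λ e → ProcessA.done s e ≡ false) →
               ∃₂ (λ i j → (1 ≤ ProcessA.μ ends s i j)
                 × (ProcessA.closable ends s i j ≤ 2 * ProcessA.μ ends s i j))
mainTheorem3 {n} ends s reachable some-unprocessed =
  let i , j , 0<wμ , wc≤2wμ = averaging₂ 2 weightedClosable weightedμ ∑wc≤2∑wμ 0<∑wμ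
  in i , j , cancel-weight (loopWeight i j) 2 0<wμ wc≤2wμ
  where
  open ProcessA ends
  open FaceCounting ends
  open ≤-Reasoning
  weightedClosable weightedμ : Fin n → Fin n → ℕ
  weightedClosable i j = loopWeight i j * closable s i j
  weightedμ i j = loopWeight i j * μ s i j
  ∑wc≤2∑wμ : ∑[ i < n ] ∑[ j < n ] weightedClosable i j ≤ 2 * ∑[ i < n ] ∑[ j < n ] weightedμ i j
  ∑wc≤2∑wμ = begin
    ∑[ i < n ] ∑[ j < n ] weightedClosable i j  ≤⟨ ∑-weighted-closable≤2*#unoccupied s ⟩
    2 * #unoccupied s                          ≡⟨ cong (2 *_) (#unoccupied≡2*#unprocessed reachable) ⟩
    2 * (2 * #unprocessed s)                   ≤⟨ *-monoʳ-≤ 2 (2*#unprocessed≤∑-weighted-μ s) ⟩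
    2 * ∑[ i < n ] ∑[ j < n ] weightedμ i j    ∎
  0<∑wμ : 0 < ∑[ i < n ] ∑[ j < n ] weightedμ i j
  0<∑wμ = <-≤-trans (*-monoʳ-< 2 (0<#unprocessed s some-unprocessed)) (2*#unprocessed≤∑-weighted-μ s)
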